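{- Let $c(n,3)$, $n\ge0$, be defined by $(1-9x)^{ -1/3}=\sum_{n\ge 0}c(n,3)x^n$. Then $c(n,3)$ is odd if and only if $n$ is a sum of distinct powers of $4$.
   Context: Equivalently $c(n,3)=(-1)^n 9^n\binom{ -1/3}{n}$, where $\binom{x}{n}=\frac{1}{n!}\prod_{j=0}^{n-1}(x-j)$. The empty sum (for $n=0$) counts as a sum of distinct powers of $4$. -}

module Defs where

open import Data.Nat as ℕ using (ℕ; zero; suc; _!; _^_)
open import Data.Nat.Properties using (_!≢0)
open import Data.Integer as ℤ using (ℤ)
open import Data.Rational using (ℚ; _/_; _*_; _-_; -_; 1ℚ)
open import Data.List using (List; map)
open import Data.Nat.ListAction using (sum)
open import Data.List.Relation.Unary.Unique.Propositional using (Unique)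
open import Data.Product using (∃; _×_)
open import Relation.Binary.PropositionalEquality using (_≡_)

ℕ→ℚ : ℕ → ℚ
ℕ→ℚ j = ℤ.+ j / 1

fallingProd : ℚ → ℕ → ℚ
fallingProd x zero    = 1ℚ
fallingProd x (suc n) = fallingProd x n * (x - ℕ→ℚ n)

binom : ℚ → ℕ → ℚ
binom x n = fallingProd x n * (ℤ.+ 1 / (n !))
  where instance _ = n !≢0

pow : ℚ → ℕ → ℚ
pow q zero    = 1ℚ
pow q (suc n) = q * pow q n

-- c(n,3): coefficient of x^n in (1 - 9x)^(-1/3) = Σ_n binom(-1/3,n) (-9x)^n
c3 : ℕ → ℚ
c3 n = pow (- (ℤ.+ 9 / 1)) n * binom (- (ℤ.+ 1 / 3)) n

OddQ : ℚ → Set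
OddQ q = ∃ λ (k : ℤ) → q ≡ ((ℤ.+ 2 ℤ.* k ℤ.+ ℤ.+ 1) / 1)

-- n is a sum of distinct powers of 4 (empty sum allowed, giving 0)
SumDistinctPow4 : ℕ → Set
SumDistinctPow4 n = ∃ λ (es : List ℕ) → Unique es × n ≡ sum (map (4 ^_) es)

module Submission where

-- The coefficients are  c(n,3) = (-9)^n binom(-1/3, n) = ∏_{j<n} 3(3j+1) / n!.
--
-- 1. Integrality.  Put  numerator n = ∏_{j<n} 3(3j+1) = 3^n ∏_{j<n} (3j+1).
--    Write n! ∣ 3^n r with 3 ∤ r (the 3-adic valuation of n! is at most n,
--    by the recursion (3m+2)! = 3^m m! ∏_{j≤m}(3j+1)(3j+2)), and choose N with
--    3N ≡ 1 (mod r).  Then 3^n N(N+1)...(N+n-1) ≡ ∏_{j<n}(3j+1) (mod r), and the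
--    rising factorial is divisible by n!, so n! ∣ numerator n.  Let a n be the
--    quotient; it satisfies (n+1) a(n+1) = 3(3n+1) a(n).
-- 2. Parity.  Write x ≃₂ y if u x = v y for some odd u, v (equal 2-adic
--    valuations).  Along a block 4m, ..., 4m+4 the recursion gives
--    a(4m+1) ≃₂ a(4m), a(4m+2) ≃₂ 2(3m+1) a(4m+1) (so it is even), a(4m+3) ≃₂ a(4m+2)
--    and 2(m+1) a(4m+4) ≃₂ a(4m+3); by induction a(4m) ≃₂ a(m).
-- 3. Hence "a n is odd" obeys the base-4 digit rules of the numbers whose digits
--    are all 0 or 1 (Digits01); so do sums of distinct powers of 4, and any two
--    predicates obeying these rules coincide (strong induction on n).
-- 4. Finally c3 n is the rational image of the natural number a n, and a
--    natural number is an odd integer as a rational iff it is odd.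

open import Defs
open import Level using (0ℓ)
open import Function.Bundles using (_⇔_; mk⇔; Equivalence)
import Function.Properties.Equivalence as ⇔
open import Data.Empty using (⊥-elim)
open import Data.Product using (∃; ∃₂; _×_; _,_; proj₁; proj₂)
open import Data.Sum using (inj₁; inj₂)
open import Relation.Nullary using (¬_)
open import Relation.Nullary.Decidable using (from-yes)
open import Relation.Binary.PropositionalEquality
import Relation.Binary.Reasoning.Setoid as SetoidReasoning

open import Data.Nat as ℕ
  using (ℕ; zero; suc; _+_; _*_; _^_; _!; _≤_; _<_; s≤s; z≤n; z<s; NonZero; _%_; _/_; >-nonZero)
open import Data.Nat.Properties
open import Algebra.Properties.CommutativeSemigroup *-commutativeSemigroup using (x∙yz≈y∙xz)
open import Data.Nat.Divisibility
open import Data.Nat.DivMod using (m≡m%n+[m/n]*n; m%n<n; m/n<m; m/n*n≤m; [m+kn]%n≡m%n; m<n⇒m%n≡m)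
open import Data.Nat.Primality using (Prime; prime?; euclidsLemma; ¬prime[1]; prime[2])
import Data.Nat.Coprimality as Coprime
open import Data.Nat.Induction using (<-rec)
open import Data.Nat.Tactic.RingSolver using (solve-∀)
open import Data.Nat.ListAction using (sum)

open import Data.Integer as ℤ using (ℤ; -[1+_])
import Data.Integer.Properties as ℤP
open import Data.Rational as ℚ using (ℚ; mkℚ; 1ℚ)
import Data.Rational.Properties as ℚP
open import Data.Rational.Solver using (module +-*-Solver)

open import Data.List using (List; []; _∷_; map)
open import Data.List.Relation.Unary.All using (All; []; _∷_)
import Data.List.Relation.Unary.All as All using (universal)
import Data.List.Relation.Unary.All.Properties as All using (map⁺)
open import Data.List.Relation.Unary.Unique.Propositional using (Unique; []; _∷_)
open import Data.List.Relation.Unary.Unique.Propositional.Properties using (map⁺)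

prod : (ℕ → ℕ) → ℕ → ℕ
prod f zero    = 1
prod f (suc n) = prod f n * f n

-- Products of pointwise equal factors agree (there is no function extensionality).
prod-cong : ∀ {f g} → (∀ j → f j ≡ g j) → ∀ n → prod f n ≡ prod g n
prod-cong f≗g zero    = refl
prod-cong f≗g (suc n) = cong₂ _*_ (prod-cong f≗g n) (f≗g n)

prod-scale : ∀ c f n → prod (λ j → c * f j) n ≡ c ^ n * prod f n
prod-scale c f zero    = refl
prod-scale c f (suc n) = begin
  prod (λ j → c * f j) n * (c * f n) ≡⟨ cong (_* (c * f n)) (prod-scale c f n) ⟩
  c ^ n * prod f n * (c * f n)       ≡⟨ regroup (c ^ n) (prod f n) (f n) c ⟩
  c * c ^ n * (prod f n * f n)       ∎
  where
  open ≡-Reasoning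
  regroup : ∀ x p y c → x * p * (c * y) ≡ c * x * (p * y)
  regroup = solve-∀

prod-shift : ∀ r t f n → ∃ λ k → prod (λ j → f j + r * t) n ≡ prod f n + r * k
prod-shift r t f zero    = 0 , cong suc (sym (*-zeroʳ r))
prod-shift r t f (suc n) with prod-shift r t f n
... | k , eq = _ , trans (cong (_* (f n + r * t)) eq) (expand (prod f n) r k (f n) t)
  where
  expand : ∀ p r k y t → (p + r * k) * (y + r * t) ≡ p * y + r * (k * (y + r * t) + p * t)
  expand = solve-∀

prime∤* : ∀ {p a b} → Prime p → ¬ p ∣ a → ¬ p ∣ b → ¬ p ∣ a * b
prime∤* {a = a} {b} pp p∤a p∤b p∣ab with euclidsLemma a b pp p∣ab
... | inj₁ p∣a = p∤a p∣a
... | inj₂ p∣b = p∤b p∣b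

prime∤prod : ∀ {p f} → Prime p → (∀ j → ¬ p ∣ f j) → ∀ n → ¬ p ∣ prod f n
prime∤prod pp p∤f zero    p∣1 = ¬prime[1] (subst Prime (∣1⇒≡1 p∣1) pp)
prime∤prod pp p∤f (suc n) = prime∤* pp (prime∤prod pp p∤f n) (p∤f n)

-- The rising factorial N (N+1) ... (N+n-1) is divisible by n!, by the Pascal-type
-- recursion  R(N+1, n+1) = R(N, n+1) + (n+1) R(N+1, n).
rising : ℕ → ℕ → ℕ
rising N = prod (N +_)

rising-head : ∀ N n → rising N (suc n) ≡ N * rising (suc N) n
rising-head N zero    = trans (*-identityˡ (N + 0)) (trans (+-identityʳ N) (sym (*-identityʳ N)))
rising-head N (suc n) = begin
  rising N (suc n) * (N + suc n)     ≡⟨ cong₂ _*_ (rising-head N n) (+-suc N n) ⟩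
  N * rising (suc N) n * (suc N + n) ≡⟨ *-assoc N _ _ ⟩
  N * rising (suc N) (suc n)         ∎
  where open ≡-Reasoning

rising-pascal : ∀ N n → rising (suc N) (suc n) ≡ rising N (suc n) + suc n * rising (suc N) n
rising-pascal N n = begin
  rising (suc N) n * (suc N + n)            ≡⟨ split (rising (suc N) n) N n ⟩
  N * rising (suc N) n + suc n * rising (suc N) n ≡⟨ cong (_+ suc n * rising (suc N) n) (rising-head N n) ⟨
  rising N (suc n) + suc n * rising (suc N) n ∎
  where
  open ≡-Reasoning
  split : ∀ x N n → x * (suc N + n) ≡ N * x + suc n * x
  split = solve-∀

n!∣rising : ∀ n N → n ! ∣ rising N n
n!∣rising zero    N       = 1∣ _
n!∣rising (suc n) zero    = subst (suc n ! ∣_) (sym (rising-head 0 n)) (_ ∣0)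
n!∣rising (suc n) (suc N) = subst (suc n ! ∣_) (sym (rising-pascal N n))
  (∣m∣n⇒∣m+n (n!∣rising (suc n) N) (*-monoʳ-∣ (suc n) (n!∣rising n (suc N))))

∤-between : ∀ {d} q r → 0 < r → r < d → ¬ d ∣ d * q + r
∤-between q r 0<r r<d d∣ =
  <⇒≱ r<d (∣⇒≤ {{>-nonZero 0<r}} (∣m+n∣m⇒∣n d∣ (m∣m*n q)))

prime[3] : Prime 3
prime[3] = from-yes (prime? 3)

-- (3m+2)! = 3^m · m! · ∏_{j≤m} (3j+1)(3j+2): the multiples of 3 up to 3m
-- contribute 3^m m!, the remaining factors are prime to 3.
prime-to-3 : ℕ → ℕ
prime-to-3 j = (3 * j + 1) * (3 * j + 2)

factorial-3m+2 : ∀ m → (2 + 3 * m) ! ≡ 3 ^ m * m ! * prod prime-to-3 (suc m)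
factorial-3m+2 zero    = refl
factorial-3m+2 (suc m) = begin
  (2 + 3 * suc m) !
    ≡⟨ cong _! (index m) ⟩
  (5 + 3 * m) * ((4 + 3 * m) * ((3 + 3 * m) * (2 + 3 * m) !))
    ≡⟨ cong (λ z → (5 + 3 * m) * ((4 + 3 * m) * ((3 + 3 * m) * z))) (factorial-3m+2 m) ⟩
  (5 + 3 * m) * ((4 + 3 * m) * ((3 + 3 * m) * (3 ^ m * m ! * p)))
    ≡⟨ regroup m (3 ^ m) (m !) p ⟩
  3 ^ suc m * suc m ! * prod prime-to-3 (suc (suc m)) ∎
  where
  open ≡-Reasoning
  p = prod prime-to-3 (suc m)
  index : ∀ m → 2 + 3 * suc m ≡ 5 + 3 * m
  index = solve-∀
  regroup : ∀ m x f p → (5 + 3 * m) * ((4 + 3 * m) * ((3 + 3 * m) * (x * f * p)))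
                      ≡ 3 * x * ((1 + m) * f) * (p * ((3 * (1 + m) + 1) * (3 * (1 + m) + 2)))
  regroup = solve-∀

3∤prime-to-3 : ∀ j → ¬ 3 ∣ prime-to-3 j
3∤prime-to-3 j = prime∤* prime[3] (∤-between j 1 z<s (s≤s (s≤s z≤n))) (∤-between j 2 z<s ≤-refl)

^-mono-∣ : ∀ c {a b} → a ≤ b → c ^ a ∣ c ^ b
^-mono-∣ c {a} a≤b with m≤n⇒∃[o]m+o≡n a≤b
... | d , refl = divides (c ^ d) (trans (^-distribˡ-+-* c a d) (*-comm (c ^ a) (c ^ d)))

-- The 3-free part of n!: n! ∣ 3^n r with 3 ∤ r, i.e. the 3-adic valuation of n! is
-- at most n.  With m = ⌊n/3⌋:  n! ∣ (3m+2)! = 3^m m! X ∣ 3^(2m) r X  and 2m ≤ n.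
ThreeFree : ℕ → Set
ThreeFree n = ∃ λ r → ¬ 3 ∣ r × n ! ∣ 3 ^ n * r

threeFree : ∀ n → ThreeFree n
threeFree = <-rec ThreeFree step
  where
  step : ∀ n → (∀ {m} → m < n → ThreeFree m) → ThreeFree n
  step zero    _  = 1 , ∤-between 0 1 z<s (s≤s (s≤s z≤n)) , ∣-refl
  step n@(suc _) ih with ih (m/n<m n 3 (s≤s (s≤s z≤n)))
  ... | r , 3∤r , m!∣ = r * X , prime∤* prime[3] 3∤r 3∤X , n!∣
    where
    m = n / 3
    X = prod prime-to-3 (suc m)
    3∤X : ¬ 3 ∣ X
    3∤X = prime∤prod prime[3] 3∤prime-to-3 (suc m)
    n≤3m+2 : n ≤ 2 + 3 * m
    n≤3m+2 = ≤-trans (≤-reflexive (m≡m%n+[m/n]*n n 3))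
                     (+-mono-≤ (≤-pred (m%n<n n 3)) (≤-reflexive (*-comm m 3)))
    2m≤n : m + m ≤ n
    2m≤n = ≤-trans (+-monoʳ-≤ m (m≤m+n m (m + 0))) (≤-trans (≤-reflexive (*-comm 3 m)) (m/n*n≤m n 3))
    n!∣ : n ! ∣ 3 ^ n * (r * X)
    n!∣ = begin
      n !                       ∣⟨ m≤n⇒m!∣n! n≤3m+2 ⟩
      (2 + 3 * m) !             ≡⟨ factorial-3m+2 m ⟩
      3 ^ m * m ! * X           ∣⟨ *-monoˡ-∣ X (*-monoʳ-∣ (3 ^ m) m!∣) ⟩
      3 ^ m * (3 ^ m * r) * X   ≡⟨ regroup (3 ^ m) r X ⟨
      3 ^ m * 3 ^ m * (r * X)   ≡⟨ cong (_* (r * X)) (^-distribˡ-+-* 3 m m) ⟨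
      3 ^ (m + m) * (r * X)     ∣⟨ *-monoˡ-∣ (r * X) (^-mono-∣ 3 2m≤n) ⟩
      3 ^ n * (r * X)           ∎
      where
      open ∣-Reasoning
      regroup : ∀ a r X → a * a * (r * X) ≡ a * (a * r) * X
      regroup = solve-∀

three-invertible : ∀ r → ¬ 3 ∣ r → ∃₂ λ N t → 3 * N ≡ 1 + r * t
three-invertible r 3∤r with r % 3 | m≡m%n+[m/n]*n r 3 | m%n<n r 3
... | 0 | r≡ | _ = ⊥-elim (3∤r (divides (r / 3) r≡))
... | 1 | r≡ | _ = 1 + 2 * (r / 3) , 2 , trans (inverse (r / 3)) (cong (λ z → 1 + z * 2) (sym r≡))
  where
  inverse : ∀ q → 3 * (1 + 2 * q) ≡ 1 + (1 + q * 3) * 2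
  inverse = solve-∀
... | 2 | r≡ | _ = 1 + r / 3 , 1 , trans (inverse (r / 3)) (cong (λ z → 1 + z * 1) (sym r≡))
  where
  inverse : ∀ q → 3 * (1 + q) ≡ 1 + (2 + q * 3) * 1
  inverse = solve-∀
... | suc (suc (suc _)) | _ | s≤s (s≤s (s≤s ()))

-- n! c(n,3) = ∏_{j<n} 3(3j+1).
numerator : ℕ → ℕ
numerator = prod (λ j → 3 * (3 * j + 1))

-- Integrality of c(n,3).  With n! ∣ 3^n r, 3 ∤ r and 3N = 1 + r t:
--   3^n · 3^n R(N,n) = 3^n ∏(3j+1 + r t) = numerator n + 3^n r k,
-- and n! divides both 3^n · 3^n R(N,n) and 3^n r k.
n!∣numerator : ∀ n → n ! ∣ numerator n
n!∣numerator n with threeFree n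
... | r , 3∤r , n!∣3ⁿr with three-invertible r 3∤r
... | N , t , 3N≡ with prod-shift r t (λ j → 3 * j + 1) n
... | k , shifted = ∣m+n∣m⇒∣n (subst (n ! ∣_) expand n!∣lhs) (∣m⇒∣m*n k n!∣3ⁿr)
  where
  open ≡-Reasoning
  scaled-rising : 3 ^ n * rising N n ≡ prod (λ j → 3 * j + 1) n + r * k
  scaled-rising = begin
    3 ^ n * rising N n                    ≡⟨ prod-scale 3 (N +_) n ⟨
    prod (λ j → 3 * (N + j)) n            ≡⟨ prod-cong shift n ⟩
    prod (λ j → 3 * j + 1 + r * t) n      ≡⟨ shifted ⟩
    prod (λ j → 3 * j + 1) n + r * k      ∎
    where
    shift : ∀ j → 3 * (N + j) ≡ 3 * j + 1 + r * t
    shift j = begin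
      3 * (N + j)         ≡⟨ *-distribˡ-+ 3 N j ⟩
      3 * N + 3 * j       ≡⟨ cong (_+ 3 * j) 3N≡ ⟩
      1 + r * t + 3 * j   ≡⟨ +-comm (1 + r * t) (3 * j) ⟩
      3 * j + (1 + r * t) ≡⟨ +-assoc (3 * j) 1 (r * t) ⟨
      3 * j + 1 + r * t   ∎
  expand : 3 ^ n * (3 ^ n * rising N n) ≡ 3 ^ n * r * k + numerator n
  expand = begin
    3 ^ n * (3 ^ n * rising N n)                    ≡⟨ cong (3 ^ n *_) scaled-rising ⟩
    3 ^ n * (prod (λ j → 3 * j + 1) n + r * k)      ≡⟨ *-distribˡ-+ (3 ^ n) _ (r * k) ⟩
    3 ^ n * prod (λ j → 3 * j + 1) n + 3 ^ n * (r * k)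
      ≡⟨ cong₂ _+_ (prod-scale 3 (λ j → 3 * j + 1) n) (*-assoc (3 ^ n) r k) ⟨
    numerator n + 3 ^ n * r * k                     ≡⟨ +-comm (numerator n) _ ⟩
    3 ^ n * r * k + numerator n                     ∎
  n!∣lhs : n ! ∣ 3 ^ n * (3 ^ n * rising N n)
  n!∣lhs = ∣n⇒∣m*n (3 ^ n) (∣n⇒∣m*n (3 ^ n) (n!∣rising n N))

-- a n = c(n,3) as a natural number, characterised by  numerator n = a n · n!.
opaque
  a : ℕ → ℕ
  a n = quotient (n!∣numerator n)

  a-spec : ∀ n → numerator n ≡ a n * n !
  a-spec n = _∣_.equality (n!∣numerator n)

a-zero : a 0 ≡ 1
a-zero = sym (trans (a-spec 0) (*-identityʳ (a 0)))

a-rec : ∀ n → suc n * a (suc n) ≡ 3 * (3 * n + 1) * a n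
a-rec n = *-cancelʳ-≡ _ _ (n !) {{n !≢0}} (begin
  suc n * a (suc n) * n !          ≡⟨ regroup (suc n) (a (suc n)) (n !) ⟩
  a (suc n) * suc n !              ≡⟨ a-spec (suc n) ⟨
  numerator n * (3 * (3 * n + 1))  ≡⟨ cong (_* (3 * (3 * n + 1))) (a-spec n) ⟩
  a n * n ! * (3 * (3 * n + 1))    ≡⟨ regroup′ (a n) (n !) (3 * (3 * n + 1)) ⟩
  3 * (3 * n + 1) * a n * n !      ∎)
  where
  open ≡-Reasoning
  regroup : ∀ s x f → s * x * f ≡ x * (s * f)
  regroup = solve-∀
  regroup′ : ∀ x f c → x * f * c ≡ c * x * f
  regroup′ = solve-∀

Odd : ℕ → Set
Odd x = ¬ 2 ∣ x

odd : ∀ k → Odd (2 * k + 1)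
odd k = ∤-between k 1 z<s ≤-refl

even-double : ∀ x → ¬ Odd (2 * x)
even-double x odd-2x = odd-2x (m∣m*n x)

odd-* : ∀ {x y} → Odd x → Odd y → Odd (x * y)
odd-* = prime∤* prime[2]

-- x ≃₂ y: x and y differ only by odd factors (they have the same 2-adic valuation).
infix 4 _≃₂_
_≃₂_ : ℕ → ℕ → Set
x ≃₂ y = ∃₂ λ u v → Odd u × Odd v × u * x ≡ v * y

≃₂-refl : ∀ x → x ≃₂ x
≃₂-refl x = 1 , 1 , odd 0 , odd 0 , refl

≃₂-scaled : ∀ {u x y} → Odd u → u * x ≡ y → x ≃₂ y
≃₂-scaled {y = y} odd-u eq = _ , 1 , odd-u , odd 0 , trans eq (sym (*-identityˡ y))

≃₂-trans : ∀ {x y z} → x ≃₂ y → y ≃₂ z → x ≃₂ z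
≃₂-trans {x} {y} {z} (u , v , ou , ov , ux≡vy) (u′ , v′ , ou′ , ov′ , u′y≡v′z) =
  u′ * u , v * v′ , odd-* ou′ ou , odd-* ov ov′ , (begin
    u′ * u * x     ≡⟨ *-assoc u′ u x ⟩
    u′ * (u * x)   ≡⟨ cong (u′ *_) ux≡vy ⟩
    u′ * (v * y)   ≡⟨ x∙yz≈y∙xz u′ v y ⟩
    v * (u′ * y)   ≡⟨ cong (v *_) u′y≡v′z ⟩
    v * (v′ * z)   ≡⟨ *-assoc v v′ z ⟨
    v * v′ * z     ∎)
  where open ≡-Reasoning

≃₂-*ˡ : ∀ c {x y} → x ≃₂ y → c * x ≃₂ c * y
≃₂-*ˡ c {x} {y} (u , v , ou , ov , ux≡vy) = u , v , ou , ov , (begin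
  u * (c * x)   ≡⟨ x∙yz≈y∙xz u c x ⟩
  c * (u * x)   ≡⟨ cong (c *_) ux≡vy ⟩
  c * (v * y)   ≡⟨ x∙yz≈y∙xz c v y ⟩
  v * (c * y)   ∎)
  where open ≡-Reasoning

≃₂-cancelˡ : (c : ℕ) .{{_ : NonZero c}} {x y : ℕ} → c * x ≃₂ c * y → x ≃₂ y
≃₂-cancelˡ c {x} {y} (u , v , ou , ov , eq) = u , v , ou , ov ,
  *-cancelˡ-≡ (u * x) (v * y) c
    (trans (x∙yz≈y∙xz c u x) (trans eq (x∙yz≈y∙xz v c y)))

≃₂-odd : ∀ {x y} → x ≃₂ y → Odd x ⇔ Odd y
≃₂-odd {x} {y} (u , v , ou , ov , ux≡vy) = mk⇔
  (λ ox 2∣y → odd-* ou ox (subst (2 ∣_) (sym ux≡vy) (∣n⇒∣m*n v 2∣y)))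
  (λ oy 2∣x → odd-* ov oy (subst (2 ∣_) ux≡vy (∣n⇒∣m*n u 2∣x)))

-- Consequences of the recursion  (n+1) a(n+1) = 3(3n+1) a(n)  on the 2-adic
-- valuation of a along one block 4m, ..., 4m+4.  Each is the recursion with its
-- factors written as (odd) · (power of 2).
a-4m+1 : ∀ m → a (1 + 4 * m) ≃₂ a (4 * m)
a-4m+1 m = _ , _ , odd (2 * m) , odd (18 * m + 1) ,
  trans (shapeˡ m (a (1 + 4 * m))) (trans (a-rec (4 * m)) (shapeʳ m (a (4 * m))))
  where
  shapeˡ : ∀ m x → (2 * (2 * m) + 1) * x ≡ suc (4 * m) * x
  shapeˡ = solve-∀
  shapeʳ : ∀ m y → 3 * (3 * (4 * m) + 1) * y ≡ (2 * (18 * m + 1) + 1) * y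
  shapeʳ = solve-∀

a-4m+2 : ∀ m → a (2 + 4 * m) ≃₂ 2 * ((3 * m + 1) * a (1 + 4 * m))
a-4m+2 m = _ , _ , odd m , odd 1 ,
  *-cancelˡ-≡ _ _ 2
    (trans (shapeˡ m (a (2 + 4 * m))) (trans (a-rec (1 + 4 * m)) (shapeʳ m (a (1 + 4 * m)))))
  where
  shapeˡ : ∀ m x → 2 * ((2 * m + 1) * x) ≡ suc (suc (4 * m)) * x
  shapeˡ = solve-∀
  shapeʳ : ∀ m y → 3 * (3 * (1 + 4 * m) + 1) * y ≡ 2 * ((2 * 1 + 1) * (2 * ((3 * m + 1) * y)))
  shapeʳ = solve-∀

a-4m+3 : ∀ m → a (3 + 4 * m) ≃₂ a (2 + 4 * m)
a-4m+3 m = _ , _ , odd (2 * m + 1) , odd (18 * m + 10) ,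
  trans (shapeˡ m (a (3 + 4 * m))) (trans (a-rec (2 + 4 * m)) (shapeʳ m (a (2 + 4 * m))))
  where
  shapeˡ : ∀ m x → (2 * (2 * m + 1) + 1) * x ≡ suc (suc (suc (4 * m))) * x
  shapeˡ = solve-∀
  shapeʳ : ∀ m y → 3 * (3 * (2 + 4 * m) + 1) * y ≡ (2 * (18 * m + 10) + 1) * y
  shapeʳ = solve-∀

a-4m+4 : ∀ m → 2 * (suc m * a (4 * suc m)) ≃₂ a (3 + 4 * m)
a-4m+4 m = _ , _ , odd 0 , odd (9 * m + 7) ,
  *-cancelˡ-≡ _ _ 2 (begin
    2 * (1 * (2 * (suc m * a (4 * suc m))))  ≡⟨ cong (λ k → 2 * (1 * (2 * (suc m * a k)))) (index m) ⟩
    2 * (1 * (2 * (suc m * a (4 + 4 * m))))  ≡⟨ shapeˡ m (a (4 + 4 * m)) ⟩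
    (4 + 4 * m) * a (4 + 4 * m)              ≡⟨ a-rec (3 + 4 * m) ⟩
    3 * (3 * (3 + 4 * m) + 1) * a (3 + 4 * m) ≡⟨ shapeʳ m (a (3 + 4 * m)) ⟩
    2 * ((2 * (9 * m + 7) + 1) * a (3 + 4 * m)) ∎)
  where
  open ≡-Reasoning
  index : ∀ m → 4 * suc m ≡ 4 + 4 * m
  index = solve-∀
  shapeˡ : ∀ m x → 2 * (1 * (2 * (suc m * x))) ≡ (4 + 4 * m) * x
  shapeˡ = solve-∀
  shapeʳ : ∀ m y → 3 * (3 * (3 + 4 * m) + 1) * y ≡ 2 * ((2 * (9 * m + 7) + 1) * y)
  shapeʳ = solve-∀

a-m+1 : ∀ m → (3 * m + 1) * a m ≃₂ suc m * a (suc m)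
a-m+1 m = ≃₂-scaled (odd 1) (trans (sym (*-assoc 3 (3 * m + 1) (a m))) (sym (a-rec m)))

-- a(4m) and a(m) have the same 2-adic valuation: chain the block relations from
-- 4(m+1) down to 4m, use induction, and come back up with the recursion at m.
a-4m : ∀ m → a (4 * m) ≃₂ a m
a-4m zero    = ≃₂-refl (a 0)
a-4m (suc m) = ≃₂-cancelˡ (suc m) (≃₂-cancelˡ 2
  (≃₂-trans (a-4m+4 m)              -- 2(m+1) a(4m+4) ≃₂ a(4m+3)
  (≃₂-trans (a-4m+3 m)              --                ≃₂ a(4m+2)
  (≃₂-trans (a-4m+2 m)              --                ≃₂ 2(3m+1) a(4m+1)
  (≃₂-*ˡ 2 (≃₂-trans
    (≃₂-*ˡ (3 * m + 1) (≃₂-trans (a-4m+1 m) (a-4m m)))   -- ≃₂ 2(3m+1) a(m)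
    (a-m+1 m)))))))                                       -- ≃₂ 2(m+1) a(m+1)

-- The base-4 digit rules of the numbers all of whose base-4 digits are 0 or 1.
record Digits01 (A : ℕ → Set) : Set where
  field
    at-zero : A 0
    digit0  : ∀ m → A (4 * m) ⇔ A m
    digit1  : ∀ m → A (1 + 4 * m) ⇔ A m
    digit2  : ∀ m → ¬ A (2 + 4 * m)
    digit3  : ∀ m → ¬ A (3 + 4 * m)

digits01-unique : ∀ {A B} → Digits01 A → Digits01 B → ∀ n → A n ⇔ B n
digits01-unique {A} {B} DA DB = <-rec (λ n → A n ⇔ B n) step
  where
  module DA = Digits01 DA
  module DB = Digits01 DB
  by-digit : ∀ r m → r < 4 → A m ⇔ B m → A (r + 4 * m) ⇔ B (r + 4 * m)
  by-digit 0 m _ A⇔B = ⇔.trans (DA.digit0 m) (⇔.trans A⇔B (⇔.sym (DB.digit0 m)))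
  by-digit 1 m _ A⇔B = ⇔.trans (DA.digit1 m) (⇔.trans A⇔B (⇔.sym (DB.digit1 m)))
  by-digit 2 m _ _   = mk⇔ (λ x → ⊥-elim (DA.digit2 m x)) (λ y → ⊥-elim (DB.digit2 m y))
  by-digit 3 m _ _   = mk⇔ (λ x → ⊥-elim (DA.digit3 m x)) (λ y → ⊥-elim (DB.digit3 m y))
  by-digit (suc (suc (suc (suc _)))) m (s≤s (s≤s (s≤s (s≤s ())))) _
  step : ∀ n → (∀ {m} → m < n → A m ⇔ B m) → A n ⇔ B n
  step zero      _  = mk⇔ (λ _ → DB.at-zero) (λ _ → DA.at-zero)
  step n@(suc _) ih = subst (λ k → A k ⇔ B k) (sym n≡)
    (by-digit (n % 4) (n / 4) (m%n<n n 4) (ih (m/n<m n 4 (s≤s (s≤s z≤n)))))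
    where
    n≡ : n ≡ n % 4 + 4 * (n / 4)
    n≡ = trans (m≡m%n+[m/n]*n n 4) (cong (n % 4 +_) (*-comm (n / 4) 4))

odd-a-digits : Digits01 (λ n → Odd (a n))
odd-a-digits = record
  { at-zero = subst Odd (sym a-zero) (odd 0)
  ; digit0  = λ m → ≃₂-odd (a-4m m)
  ; digit1  = λ m → ⇔.trans (≃₂-odd (a-4m+1 m)) (≃₂-odd (a-4m m))
  ; digit2  = a-4m+2-even
  ; digit3  = λ m odd-a → a-4m+2-even m (Equivalence.to (≃₂-odd (a-4m+3 m)) odd-a)
  }
  where
  a-4m+2-even : ∀ m → ¬ Odd (a (2 + 4 * m))
  a-4m+2-even m odd-a =
    even-double ((3 * m + 1) * a (1 + 4 * m)) (Equivalence.to (≃₂-odd (a-4m+2 m)) odd-a)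

value : List ℕ → ℕ
value es = sum (map (4 ^_) es)

zeros : List ℕ → ℕ
zeros []           = 0
zeros (zero  ∷ es) = suc (zeros es)
zeros (suc _ ∷ es) = zeros es

lowered : List ℕ → List ℕ
lowered []           = []
lowered (zero  ∷ es) = lowered es
lowered (suc e ∷ es) = e ∷ lowered es

value-split : ∀ es → value es ≡ zeros es + 4 * value (lowered es)
value-split []           = refl
value-split (zero  ∷ es) = cong suc (value-split es)
value-split (suc e ∷ es) =
  trans (cong (4 ^ suc e +_) (value-split es)) (regroup (4 ^ e) (zeros es) (value (lowered es)))
  where
  regroup : ∀ p z v → 4 * p + (z + 4 * v) ≡ z + 4 * (p + v)
  regroup = solve-∀

zeros-absent : ∀ {es} → All (0 ≢_) es → zeros es ≡ 0
zeros-absent {[]}         []          = refl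
zeros-absent {zero  ∷ _}  (0≢0 ∷ _)   = ⊥-elim (0≢0 refl)
zeros-absent {suc _ ∷ _}  (_ ∷ 0∉es)  = zeros-absent 0∉es

zeros≤1 : ∀ {es} → Unique es → zeros es ≤ 1
zeros≤1 {[]}         []          = z≤n
zeros≤1 {zero  ∷ _}  (0∉es ∷ _)  = s≤s (≤-reflexive (zeros-absent 0∉es))
zeros≤1 {suc _ ∷ _}  (_ ∷ u)     = zeros≤1 u

lowered-absent : ∀ {e es} → All (suc e ≢_) es → All (e ≢_) (lowered es)
lowered-absent {es = []}         []          = []
lowered-absent {es = zero  ∷ _}  (_ ∷ e∉es)  = lowered-absent e∉es
lowered-absent {es = suc _ ∷ _}  (e≢ ∷ e∉es) = (λ eq → e≢ (cong suc eq)) ∷ lowered-absent e∉es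

lowered-unique : ∀ {es} → Unique es → Unique (lowered es)
lowered-unique {[]}         []          = []
lowered-unique {zero  ∷ _}  (_ ∷ u)     = lowered-unique u
lowered-unique {suc _ ∷ _}  (e∉es ∷ u)  = lowered-absent e∉es ∷ lowered-unique u

value-shift : ∀ ds → value (map suc ds) ≡ 4 * value ds
value-shift []       = refl
value-shift (d ∷ ds) =
  trans (cong (4 ^ suc d +_) (value-shift ds)) (sym (*-distribˡ-+ 4 (4 ^ d) (value ds)))

base4-unique : ∀ {r s m m′} → r < 4 → s < 4 → r + 4 * m ≡ s + 4 * m′ → r ≡ s × m ≡ m′
base4-unique {r} {s} {m} {m′} r<4 s<4 eq =
  r≡s , *-cancelˡ-≡ m m′ 4 (+-cancelˡ-≡ r _ _ (trans eq (cong (_+ 4 * m′) (sym r≡s))))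
  where
  last-digit : ∀ {t} k → t < 4 → (t + 4 * k) % 4 ≡ t
  last-digit {t} k t<4 =
    trans (cong (λ z → (t + z) % 4) (*-comm 4 k)) (trans ([m+kn]%n≡m%n t k 4) (m<n⇒m%n≡m t<4))
  r≡s : r ≡ s
  r≡s = trans (sym (last-digit m r<4)) (trans (cong (_% 4) eq) (last-digit m′ s<4))

sumPow4-digit : ∀ r m → r < 4 → SumDistinctPow4 (r + 4 * m) → r ≤ 1 × SumDistinctPow4 m
sumPow4-digit r m r<4 (es , u , eq)
  with base4-unique r<4 (s≤s (≤-trans (zeros≤1 u) (s≤s z≤n))) (trans eq (value-split es))
... | r≡ , m≡ = subst (_≤ 1) (sym r≡) (zeros≤1 u) , lowered es , lowered-unique u , m≡

sumPow4-4m : ∀ m → SumDistinctPow4 m → SumDistinctPow4 (4 * m)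
sumPow4-4m m (ds , u , eq) =
  map suc ds , map⁺ suc-injective u , trans (cong (4 *_) eq) (sym (value-shift ds))

sumPow4-1+4m : ∀ m → SumDistinctPow4 m → SumDistinctPow4 (1 + 4 * m)
sumPow4-1+4m m (ds , u , eq) =
  0 ∷ map suc ds , All.map⁺ (All.universal (λ _ ()) ds) ∷ map⁺ suc-injective u ,
  cong suc (trans (cong (4 *_) eq) (sym (value-shift ds)))

sumPow4-digits : Digits01 SumDistinctPow4
sumPow4-digits = record
  { at-zero = [] , [] , refl
  ; digit0  = λ m → mk⇔ (λ s → proj₂ (sumPow4-digit 0 m z<s s)) (sumPow4-4m m)
  ; digit1  = λ m → mk⇔ (λ s → proj₂ (sumPow4-digit 1 m (s≤s z<s) s)) (sumPow4-1+4m m)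
  ; digit2  = λ m s → digit>1 (proj₁ (sumPow4-digit 2 m (s≤s (s≤s z<s)) s))
  ; digit3  = λ m s → digit>1 (proj₁ (sumPow4-digit 3 m ≤-refl s))
  }
  where
  digit>1 : ∀ {r} → ¬ 2 + r ≤ 1
  digit>1 (s≤s ())

ι : ℤ → ℚ
ι i = i ℚ./ 1

ι-normal : ∀ i → ι i ≡ mkℚ i 0 (Coprime.sym (Coprime.1-coprimeTo ℤ.∣ i ∣))
ι-normal (ℤ.+ n)  = ℚP.normalize-coprime (Coprime.sym (Coprime.1-coprimeTo n))
ι-normal -[1+ n ] = cong ℚ.-_ (ℚP.normalize-coprime (Coprime.sym (Coprime.1-coprimeTo (suc n))))

ι-injective : ∀ {i j} → ι i ≡ ι j → i ≡ j
ι-injective {i} {j} eq = cong ℚ.↥_ (trans (sym (ι-normal i)) (trans eq (ι-normal j)))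

ι-+ : ∀ i j → ι i ℚ.+ ι j ≡ ι (i ℤ.+ j)
ι-+ i j rewrite ι-normal i | ι-normal j =
  cong₂ (λ x y → (x ℤ.+ y) ℚ./ 1) (ℤP.*-identityʳ i) (ℤP.*-identityʳ j)

ι-* : ∀ i j → ι i ℚ.* ι j ≡ ι (i ℤ.* j)
ι-* i j rewrite ι-normal i | ι-normal j = refl

ι-ℕ-* : ∀ m n → ι (ℤ.+ m) ℚ.* ι (ℤ.+ n) ≡ ι (ℤ.+ (m * n))
ι-ℕ-* m n = trans (ι-* (ℤ.+ m) (ℤ.+ n)) (cong ι (ℤP.+◃n≡+n (m * n)))

ι-inverse : ∀ f .{{_ : NonZero f}} → ι (ℤ.+ f) ℚ.* (ℤ.+ 1 ℚ./ f) ≡ 1ℚ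
ι-inverse f@(suc _) = trans
  (cong₂ ℚ._*_ (ι-normal (ℤ.+ f)) (ℚP.normalize-coprime (Coprime.1-coprimeTo f)))
  (ℚP.*-inverseʳ (mkℚ (ℤ.+ f) 0 (Coprime.sym (Coprime.1-coprimeTo f))))

minus9 : ℚ
minus9 = ℚ.- ι (ℤ.+ 9)

minusThird : ℚ
minusThird = ℚ.- (ℤ.+ 1 ℚ./ 3)

factor : ∀ n → minus9 ℚ.* (minusThird ℚ.- ℕ→ℚ n) ≡ ι (ℤ.+ (3 * (3 * n + 1)))
factor n = begin
  minus9 ℚ.* (minusThird ℚ.- ι (ℤ.+ n))
    ≡⟨ distrib (ι (ℤ.+ 9)) minusThird (ι (ℤ.+ n)) ⟩
  minus9 ℚ.* minusThird ℚ.+ ι (ℤ.+ 9) ℚ.* ι (ℤ.+ n)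
    ≡⟨ cong (ι (ℤ.+ 3) ℚ.+_) (ι-ℕ-* 9 n) ⟩
  ι (ℤ.+ 3) ℚ.+ ι (ℤ.+ (9 * n))
    ≡⟨ ι-+ (ℤ.+ 3) (ℤ.+ (9 * n)) ⟩
  ι (ℤ.+ (3 + 9 * n))
    ≡⟨ cong (λ z → ι (ℤ.+ z)) (regroup n) ⟩
  ι (ℤ.+ (3 * (3 * n + 1))) ∎
  where
  open ≡-Reasoning
  open +-*-Solver
  distrib : ∀ b x z → (ℚ.- b) ℚ.* (x ℚ.- z) ≡ (ℚ.- b) ℚ.* x ℚ.+ b ℚ.* z
  distrib = solve 3 (λ b x z → (:- b) :* (x :- z) := (:- b) :* x :+ b :* z) refl
  regroup : ∀ n → 3 + 9 * n ≡ 3 * (3 * n + 1)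
  regroup = solve-∀

scaled-falling : ∀ n → pow minus9 n ℚ.* fallingProd minusThird n ≡ ι (ℤ.+ numerator n)
scaled-falling zero    = refl
scaled-falling (suc n) = begin
  minus9 ℚ.* pow minus9 n ℚ.* (fallingProd minusThird n ℚ.* (minusThird ℚ.- ℕ→ℚ n))
    ≡⟨ interchange minus9 (pow minus9 n) (fallingProd minusThird n) (minusThird ℚ.- ℕ→ℚ n) ⟩
  pow minus9 n ℚ.* fallingProd minusThird n ℚ.* (minus9 ℚ.* (minusThird ℚ.- ℕ→ℚ n))
    ≡⟨ cong₂ ℚ._*_ (scaled-falling n) (factor n) ⟩
  ι (ℤ.+ numerator n) ℚ.* ι (ℤ.+ (3 * (3 * n + 1)))
    ≡⟨ ι-ℕ-* (numerator n) (3 * (3 * n + 1)) ⟩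
  ι (ℤ.+ numerator (suc n)) ∎
  where
  open ≡-Reasoning
  open +-*-Solver
  interchange : ∀ a p f y → a ℚ.* p ℚ.* (f ℚ.* y) ≡ p ℚ.* f ℚ.* (a ℚ.* y)
  interchange = solve 4 (λ a p f y → a :* p :* (f :* y) := p :* f :* (a :* y)) refl

c3≡a : ∀ n → c3 n ≡ ι (ℤ.+ a n)
c3≡a n = begin
  pow minus9 n ℚ.* (fallingProd minusThird n ℚ.* 1/n!)
    ≡⟨ ℚP.*-assoc (pow minus9 n) _ _ ⟨
  pow minus9 n ℚ.* fallingProd minusThird n ℚ.* 1/n!
    ≡⟨ cong (ℚ._* 1/n!) (scaled-falling n) ⟩
  ι (ℤ.+ numerator n) ℚ.* 1/n!
    ≡⟨ cong (λ z → ι (ℤ.+ z) ℚ.* 1/n!) (a-spec n) ⟩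
  ι (ℤ.+ (a n * n !)) ℚ.* 1/n!
    ≡⟨ cong (ℚ._* 1/n!) (ι-ℕ-* (a n) (n !)) ⟨
  ι (ℤ.+ a n) ℚ.* ι (ℤ.+ (n !)) ℚ.* 1/n!
    ≡⟨ ℚP.*-assoc (ι (ℤ.+ a n)) _ _ ⟩
  ι (ℤ.+ a n) ℚ.* (ι (ℤ.+ (n !)) ℚ.* 1/n!)
    ≡⟨ cong (ι (ℤ.+ a n) ℚ.*_) (ι-inverse (n !)) ⟩
  ι (ℤ.+ a n) ℚ.* 1ℚ
    ≡⟨ ℚP.*-identityʳ _ ⟩
  ι (ℤ.+ a n) ∎
  where
  open ≡-Reasoning
  instance _ = n !≢0
  1/n! : ℚ
  1/n! = ℤ.+ 1 ℚ./ (n !)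

oddQ⇔odd : ∀ x → OddQ (ι (ℤ.+ x)) ⇔ Odd x
oddQ⇔odd x = mk⇔ to from
  where
  positive : ∀ j → ℤ.+ 2 ℤ.* ℤ.+ j ℤ.+ ℤ.+ 1 ≡ ℤ.+ (2 * j + 1)
  positive j = cong (ℤ._+ ℤ.+ 1) (ℤP.+◃n≡+n (2 * j))
  negative : ∀ j → ℤ.+ 2 ℤ.* -[1+ j ] ℤ.+ ℤ.+ 1 ≡ -[1+ (j + (j + 0)) ]
  negative j = trans (ℤP.⊖-< (s≤s (subst (1 ≤_) (sym (+-suc j (j + 0))) (s≤s z≤n))))
                     (cong (λ z → ℤ.- (ℤ.+ z)) (+-suc j (j + 0)))
  to : OddQ (ι (ℤ.+ x)) → Odd x
  to (ℤ.+ j , eq) =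
    subst Odd (sym (ℤP.+-injective (trans (ι-injective {ℤ.+ x} eq) (positive j)))) (odd j)
  to (-[1+ j ] , eq) with trans (ι-injective {ℤ.+ x} eq) (negative j)
  ... | ()
  from : Odd x → OddQ (ι (ℤ.+ x))
  from odd-x with x % 2 | m≡m%n+[m/n]*n x 2 | m%n<n x 2
  ... | 0 | x≡ | _ = ⊥-elim (odd-x (divides (x / 2) x≡))
  ... | 1 | x≡ | _ =
    ℤ.+ (x / 2) , cong ι (trans (cong ℤ.+_ (trans x≡ (regroup (x / 2)))) (sym (positive (x / 2))))
    where
    regroup : ∀ q → 1 + q * 2 ≡ 2 * q + 1
    regroup = solve-∀
  ... | suc (suc _) | _ | s≤s (s≤s ())

corollary3p4 : (n : ℕ) → OddQ (c3 n) ⇔ SumDistinctPow4 n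
corollary3p4 n = begin
  OddQ (c3 n)          ≡⟨ cong OddQ (c3≡a n) ⟩
  OddQ (ι (ℤ.+ a n))   ≈⟨ oddQ⇔odd (a n) ⟩
  Odd (a n)            ≈⟨ digits01-unique odd-a-digits sumPow4-digits n ⟩
  SumDistinctPow4 n    ∎
  where open SetoidReasoning (⇔.⇔-setoid 0ℓ)
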